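{- Let $G$ be a grid intersection graph with a GIG representation in which all endpoints of distinct segments have pairwise distinct $x$- and $y$-coordinates, and let $(A,B)$ be a bipartition of $G$ into independent sets. Define four linear orders $L_\leftarrow, L_\rightarrow, L_\uparrow, L_\downarrow$ on the vertex set as follows: for each of the four directions left, right, up, down, project every segment orthogonally onto a line oriented in that direction (horizontal for left/right, vertical for up/down), obtaining an interval (possibly a point); to a vertex of $A$ assign the smallest point of its interval with respect to the orientation of the line, to a vertex of $B$ the largest point, and order the vertices by these assigned points. Then $\{L_\leftarrow, L_\rightarrow, L_\uparrow, L_\downarrow\}$ is a realizer of $Q_G$. In particular, $\dim(Q_G)\le 4$.
   Context: A grid intersection graph (GIG) is the intersection graph of a finite family of horizontal and vertical line segments in the plane in which no two parallel segments intersect (vertices are segments, adjacent iff they intersect). For a bipartite graph $G$ with bipartition $(A,B)$, $Q_G$ is the height-2 poset on $A\cup B$ in which $a< b$ iff $a\in A$, $b\in B$ and $ab$ is an edge. A realizer of a poset $P$ is a family of linear extensions of $P$ whose intersection is $P$; the dimension $\dim(P)$ is the minimum size of a realizer. -}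

module Defs where

open import Data.Bool using (Bool; true; false; if_then_else_)
open import Data.Nat using (ℕ)
open import Data.Fin using (Fin)
open import Data.Rational using (ℚ; _≤_; _<_)
open import Data.Product using (_×_; Σ)
open import Data.List using (List; length)
open import Data.List.Relation.Unary.All using (All)
open import Relation.Binary.PropositionalEquality using (_≡_; _≢_)
open import Relation.Binary.Definitions using (Irreflexive; Transitive; Trichotomous)
open import Relation.Nullary using (¬_)
open import Function.Bundles using (_⇔_)

record Segment : Set where
  field
    horiz : Bool
    xl xr yb yt : ℚ
    xl≤xr : xl ≤ xr
    yb≤yt : yb ≤ yt
    flatH : horiz ≡ true → yb ≡ yt
    flatV : horiz ≡ false → xl ≡ xr
open Segment public

Intersect : Segment → Segment → Set
Intersect s t = (xl s ≤ xr t) × (xl t ≤ xr s) × (yb s ≤ yt t) × (yb t ≤ yt s)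

IsGIGRep : {n : ℕ} → (Fin n → Segment) → Set
IsGIGRep {n} seg = (i j : Fin n) → i ≢ j → horiz (seg i) ≡ horiz (seg j) →
                   ¬ Intersect (seg i) (seg j)

DistinctCoords : {n : ℕ} → (Fin n → Segment) → Set
DistinctCoords {n} seg = (i j : Fin n) → i ≢ j →
    (xl (seg i) ≢ xl (seg j)) × (xl (seg i) ≢ xr (seg j)) ×
    (xr (seg i) ≢ xl (seg j)) × (xr (seg i) ≢ xr (seg j)) ×
    (yb (seg i) ≢ yb (seg j)) × (yb (seg i) ≢ yt (seg j)) ×
    (yt (seg i) ≢ yb (seg j)) × (yt (seg i) ≢ yt (seg j))

Edge : {n : ℕ} → (Fin n → Segment) → Fin n → Fin n → Set
Edge seg i j = (i ≢ j) × Intersect (seg i) (seg j)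

IsBipartition : {n : ℕ} → (Fin n → Segment) → (Fin n → Bool) → Set
IsBipartition {n} seg inA = (i j : Fin n) → Edge seg i j → inA i ≢ inA j

Q : {n : ℕ} → (Fin n → Segment) → (Fin n → Bool) → Fin n → Fin n → Set
Q seg inA a b = (inA a ≡ true) × (inA b ≡ false) × Edge seg a b

IsLinearExtension : {n : ℕ} → (P L : Fin n → Fin n → Set) → Set
IsLinearExtension {n} P L =
  Irreflexive _≡_ L × Transitive L × Trichotomous _≡_ L ×
  ((u v : Fin n) → P u v → L u v)

IsRealizer : {n : ℕ} → (P : Fin n → Fin n → Set) → List (Fin n → Fin n → Set) → Set₁
IsRealizer {n} P Ls =
  All (IsLinearExtension P) Ls ×
  ((u v : Fin n) → P u v ⇔ All (λ L → L u v) Ls)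

DimLE : {n : ℕ} → (P : Fin n → Fin n → Set) → ℕ → Set₁
DimLE {n} P k = Σ (List (Fin n → Fin n → Set)) λ Ls → (length Ls Data.Nat.≤ k) × IsRealizer P Ls

-- Assigned points: on a line oriented in a given direction, A-vertices get the
-- smallest point of their projection interval and B-vertices the largest one
-- (smallest/largest w.r.t. the orientation of the line).
keyRight keyLeft keyUp keyDown : {n : ℕ} → (Fin n → Segment) → (Fin n → Bool) → Fin n → ℚ
keyRight seg inA v = if inA v then xl (seg v) else xr (seg v)
keyLeft  seg inA v = if inA v then xr (seg v) else xl (seg v)
keyUp    seg inA v = if inA v then yb (seg v) else yt (seg v)
keyDown  seg inA v = if inA v then yt (seg v) else yb (seg v)

-- The four orders; u precedes v iff u's point comes first along the oriented line.
L→ L← L↑ L↓ : {n : ℕ} → (Fin n → Segment) → (Fin n → Bool) → Fin n → Fin n → Set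
L→ seg inA u v = keyRight seg inA u < keyRight seg inA v
L← seg inA u v = keyLeft seg inA v < keyLeft seg inA u
L↑ seg inA u v = keyUp seg inA u < keyUp seg inA v
L↓ seg inA u v = keyDown seg inA v < keyDown seg inA u

{-# OPTIONS --safe #-}
-- An A-vertex is placed at the near end of its projection and a B-vertex at
-- the far end, so for an edge ab with a ∈ A, b ∈ B the overlap of the
-- projections puts a before b in all four orders (strictly, as endpoint
-- coordinates are distinct).  Conversely, let u precede v in all four orders.
-- If u ∈ B and v ∈ A, the x-projections would each lie strictly to the left of
-- the other.  If u and v lie on the same side, one segment would lie strictly
-- inside the other, impossible since a segment has empty interior.  Hence u ∈ A, v ∈ B, and the four comparisons are exactly the
-- intersection conditions.
module Submission where

open import Defs
open import Data.Nat using (ℕ; s≤s; z≤n)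
open import Data.Fin using (Fin)
open import Data.Fin.Properties using (_≟_)
open import Data.Bool using (Bool; true; false; if_then_else_)
open import Data.Product using (_×_; _,_)
open import Data.Sum using (_⊎_; inj₁; inj₂)
open import Data.List using (_∷_; [])
open import Data.List.Relation.Unary.All using (_∷_; [])
open import Data.Rational using (ℚ; _≤_; _<_)
open import Data.Rational.Properties
  using (<-cmp; <-irrefl; <-trans; <⇒≤; <-≤-trans; ≤-<-trans; <-isStrictTotalOrder)
open import Data.Empty using (⊥-elim)
open import Function using (_on_; _∘_)
open import Function.Bundles using (mk⇔)
open import Function.Definitions using (Injective)
open import Relation.Binary.Core using (Rel; _⇒_)
open import Relation.Binary.Structures using (IsStrictTotalOrder)
open import Relation.Binary.Definitions using (DecidableEquality; Trichotomous; tri<; tri≈; tri>)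
open import Relation.Binary.PropositionalEquality
  using (_≡_; _≢_; refl; sym; cong; isEquivalence; resp₂)
open import Relation.Nullary using (¬_)
open import Relation.Nullary.Decidable using (decidable-stable)
import Relation.Binary.Construct.Flip.EqAndOrd as Flip

≤∧≢⇒< : {p q : ℚ} → p ≤ q → p ≢ q → p < q
≤∧≢⇒< {p} {q} p≤q p≢q with <-cmp p q
... | tri< p<q _ _ = p<q
... | tri≈ _ p≡q _ = ⊥-elim (p≢q p≡q)
... | tri> _ _ q<p = ⊥-elim (<-irrefl refl (<-≤-trans q<p p≤q))

module _ {a b ℓ} {A : Set a} {B : Set b} {_<ᴮ_ : Rel B ℓ}
         (sto : IsStrictTotalOrder _≡_ _<ᴮ_) {f : A → B}
         (f-injective : Injective _≡_ _≡_ f) where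
  open IsStrictTotalOrder sto using (irrefl; trans; compare)

  on-injective-isStrictTotalOrder : IsStrictTotalOrder _≡_ (_<ᴮ_ on f)
  on-injective-isStrictTotalOrder = record
    { isStrictPartialOrder = record
      { isEquivalence = isEquivalence
      ; irrefl        = λ { refl → irrefl refl }
      ; trans         = trans
      ; <-resp-≈      = resp₂ (_<ᴮ_ on f)
      }
    ; compare = compare-on
    }
    where
    compare-on : Trichotomous _≡_ (_<ᴮ_ on f)
    compare-on x y with compare (f x) (f y)
    ... | tri< lt ne gt = tri< lt (ne ∘ cong f) gt
    ... | tri≈ lt eq gt = tri≈ lt (f-injective eq) gt
    ... | tri> lt ne gt = tri> lt (ne ∘ cong f) gt

isLinearExtension : {n : ℕ} {P L : Fin n → Fin n → Set} →
                    IsStrictTotalOrder _≡_ L → P ⇒ L → IsLinearExtension P L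
isLinearExtension sto P⇒L = irrefl , trans , compare , λ _ _ → P⇒L
  where open IsStrictTotalOrder sto

yb≡yt⊎xl≡xr : (s : Segment) → yb s ≡ yt s ⊎ xl s ≡ xr s
yb≡yt⊎xl≡xr s with horiz s in eq
... | true  = inj₁ (flatH s eq)
... | false = inj₂ (flatV s eq)

StrictlyInside : Segment → Segment → Set
StrictlyInside t s = (xl s < xl t) × (xr t < xr s) × (yb s < yb t) × (yt t < yt s)

¬StrictlyInside : (t s : Segment) → ¬ StrictlyInside t s
¬StrictlyInside t s (xl< , <xr , yb< , <yt) with yb≡yt⊎xl≡xr s
... | inj₁ yb≡yt = <-irrefl yb≡yt (<-trans yb< (≤-<-trans (yb≤yt t) <yt))
... | inj₂ xl≡xr = <-irrefl xl≡xr (<-trans xl< (≤-<-trans (xl≤xr t) <xr))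

LeftOf : Segment → Segment → Set
LeftOf s t = xr s < xl t

LeftOf-asym : (s t : Segment) → LeftOf s t → ¬ LeftOf t s
LeftOf-asym s t s<t t<s =
  <-irrefl refl (≤-<-trans (xl≤xr s) (<-trans s<t (≤-<-trans (xl≤xr t) t<s)))

XEndpoint YEndpoint : Segment → ℚ → Set
XEndpoint s p = p ≡ xl s ⊎ p ≡ xr s
YEndpoint s p = p ≡ yb s ⊎ p ≡ yt s

module _ {n : ℕ} (seg : Fin n → Segment) (dc : DistinctCoords seg) where

  xEndpoints-distinct : ∀ {i j p q} → i ≢ j →
                        XEndpoint (seg i) p → XEndpoint (seg j) q → p ≢ q
  xEndpoints-distinct {i} {j} i≢j p-end q-end with dc i j i≢j | p-end | q-end
  ... | ll , _  , _  , _  , _ | inj₁ refl | inj₁ refl = ll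
  ... | _  , lr , _  , _  , _ | inj₁ refl | inj₂ refl = lr
  ... | _  , _  , rl , _  , _ | inj₂ refl | inj₁ refl = rl
  ... | _  , _  , _  , rr , _ | inj₂ refl | inj₂ refl = rr

  yEndpoints-distinct : ∀ {i j p q} → i ≢ j →
                        YEndpoint (seg i) p → YEndpoint (seg j) q → p ≢ q
  yEndpoints-distinct {i} {j} i≢j p-end q-end with dc i j i≢j | p-end | q-end
  ... | _ , _ , _ , _ , bb , _  , _  , _  | inj₁ refl | inj₁ refl = bb
  ... | _ , _ , _ , _ , _  , bt , _  , _  | inj₁ refl | inj₂ refl = bt
  ... | _ , _ , _ , _ , _  , _  , tb , _  | inj₂ refl | inj₁ refl = tb
  ... | _ , _ , _ , _ , _  , _  , _  , tt | inj₂ refl | inj₂ refl = tt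

if-elim : ∀ {a p} {A : Set a} (P : A → Set p) (b : Bool) {x y : A} →
          P x → P y → P (if b then x else y)
if-elim P true  px _  = px
if-elim P false _  py = py

module _ {n : ℕ} (seg : Fin n → Segment) (inA : Fin n → Bool) where

  keyRight-xEndpoint : ∀ v → XEndpoint (seg v) (keyRight seg inA v)
  keyRight-xEndpoint v = if-elim (XEndpoint (seg v)) (inA v) (inj₁ refl) (inj₂ refl)

  keyLeft-xEndpoint : ∀ v → XEndpoint (seg v) (keyLeft seg inA v)
  keyLeft-xEndpoint v = if-elim (XEndpoint (seg v)) (inA v) (inj₂ refl) (inj₁ refl)

  keyUp-yEndpoint : ∀ v → YEndpoint (seg v) (keyUp seg inA v)
  keyUp-yEndpoint v = if-elim (YEndpoint (seg v)) (inA v) (inj₁ refl) (inj₂ refl)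

  keyDown-yEndpoint : ∀ v → YEndpoint (seg v) (keyDown seg inA v)
  keyDown-yEndpoint v = if-elim (YEndpoint (seg v)) (inA v) (inj₂ refl) (inj₁ refl)

choice-injective : ∀ {a b ℓ} {A : Set a} {B : Set b} → DecidableEquality A →
  (E : A → B → Set ℓ) → (∀ {i j p q} → i ≢ j → E i p → E j q → p ≢ q) →
  {k : A → B} → (∀ v → E v (k v)) → Injective _≡_ _≡_ k
choice-injective _≟ᴬ_ _ disjoint k∈E {u} {v} ku≡kv =
  decidable-stable (u ≟ᴬ v) (λ u≢v → disjoint u≢v (k∈E u) (k∈E v) ku≡kv)

key-isStrictTotalOrder : ∀ {a} {A : Set a} {k : A → ℚ} →
                         Injective _≡_ _≡_ k → IsStrictTotalOrder _≡_ (_<_ on k)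
key-isStrictTotalOrder = on-injective-isStrictTotalOrder <-isStrictTotalOrder

module _ {n : ℕ} (seg : Fin n → Segment) (inA : Fin n → Bool) {u v : Fin n} where

  L←∧L→∧L↑∧L↓⇒Q : u ≢ v → L← seg inA u v → L→ seg inA u v →
                  L↑ seg inA u v → L↓ seg inA u v → Q seg inA u v
  L←∧L→∧L↑∧L↓⇒Q u≢v uv← uv→ uv↑ uv↓ with inA u | inA v
  ... | true  | false = refl , refl , u≢v , <⇒≤ uv→ , <⇒≤ uv← , <⇒≤ uv↑ , <⇒≤ uv↓
  ... | false | true  = ⊥-elim (LeftOf-asym (seg v) (seg u) uv← uv→)
  ... | true  | true  = ⊥-elim (¬StrictlyInside (seg v) (seg u) (uv→ , uv← , uv↑ , uv↓))
  ... | false | false = ⊥-elim (¬StrictlyInside (seg u) (seg v) (uv← , uv→ , uv↓ , uv↑))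

module _ {n : ℕ} (seg : Fin n → Segment) (inA : Fin n → Bool)
         (dc : DistinctCoords seg) where

  xKey-injective : {k : Fin n → ℚ} → (∀ v → XEndpoint (seg v) (k v)) → Injective _≡_ _≡_ k
  xKey-injective = choice-injective _≟_ (XEndpoint ∘ seg) (xEndpoints-distinct seg dc)

  yKey-injective : {k : Fin n → ℚ} → (∀ v → YEndpoint (seg v) (k v)) → Injective _≡_ _≡_ k
  yKey-injective = choice-injective _≟_ (YEndpoint ∘ seg) (yEndpoints-distinct seg dc)

  L←-isStrictTotalOrder : IsStrictTotalOrder _≡_ (L← seg inA)
  L←-isStrictTotalOrder = Flip.isStrictTotalOrder
    (key-isStrictTotalOrder (xKey-injective (keyLeft-xEndpoint seg inA)))

  L→-isStrictTotalOrder : IsStrictTotalOrder _≡_ (L→ seg inA)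
  L→-isStrictTotalOrder = key-isStrictTotalOrder (xKey-injective (keyRight-xEndpoint seg inA))

  L↑-isStrictTotalOrder : IsStrictTotalOrder _≡_ (L↑ seg inA)
  L↑-isStrictTotalOrder = key-isStrictTotalOrder (yKey-injective (keyUp-yEndpoint seg inA))

  L↓-isStrictTotalOrder : IsStrictTotalOrder _≡_ (L↓ seg inA)
  L↓-isStrictTotalOrder = Flip.isStrictTotalOrder
    (key-isStrictTotalOrder (yKey-injective (keyDown-yEndpoint seg inA)))

  Q⇒L← : ∀ {u v} → Q seg inA u v → L← seg inA u v
  Q⇒L← (u∈A , v∈B , u≢v , _ , xlv≤xru , _) rewrite u∈A | v∈B =
    ≤∧≢⇒< xlv≤xru (xEndpoints-distinct seg dc (u≢v ∘ sym) (inj₁ refl) (inj₂ refl))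

  Q⇒L→ : ∀ {u v} → Q seg inA u v → L→ seg inA u v
  Q⇒L→ (u∈A , v∈B , u≢v , xlu≤xrv , _) rewrite u∈A | v∈B =
    ≤∧≢⇒< xlu≤xrv (xEndpoints-distinct seg dc u≢v (inj₁ refl) (inj₂ refl))

  Q⇒L↑ : ∀ {u v} → Q seg inA u v → L↑ seg inA u v
  Q⇒L↑ (u∈A , v∈B , u≢v , _ , _ , ybu≤ytv , _) rewrite u∈A | v∈B =
    ≤∧≢⇒< ybu≤ytv (yEndpoints-distinct seg dc u≢v (inj₁ refl) (inj₂ refl))

  Q⇒L↓ : ∀ {u v} → Q seg inA u v → L↓ seg inA u v
  Q⇒L↓ (u∈A , v∈B , u≢v , _ , _ , _ , ybv≤ytu) rewrite u∈A | v∈B =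
    ≤∧≢⇒< ybv≤ytu (yEndpoints-distinct seg dc (u≢v ∘ sym) (inj₁ refl) (inj₂ refl))

  realizer : IsRealizer (Q seg inA) (L← seg inA ∷ L→ seg inA ∷ L↑ seg inA ∷ L↓ seg inA ∷ [])
  realizer =
      ( isLinearExtension L←-isStrictTotalOrder Q⇒L←
      ∷ isLinearExtension L→-isStrictTotalOrder Q⇒L→
      ∷ isLinearExtension L↑-isStrictTotalOrder Q⇒L↑
      ∷ isLinearExtension L↓-isStrictTotalOrder Q⇒L↓
      ∷ [])
    , λ u v → mk⇔
        (λ q → Q⇒L← q ∷ Q⇒L→ q ∷ Q⇒L↑ q ∷ Q⇒L↓ q ∷ [])
        (λ { (uv← ∷ uv→ ∷ uv↑ ∷ uv↓ ∷ []) →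
               L←∧L→∧L↑∧L↓⇒Q seg inA (λ { refl → <-irrefl refl uv→ }) uv← uv→ uv↑ uv↓ })

proposition6 : (n : ℕ) (seg : Fin n → Segment) (inA : Fin n → Bool) →
    IsGIGRep seg → DistinctCoords seg → IsBipartition seg inA →
    IsRealizer (Q seg inA) (L← seg inA ∷ L→ seg inA ∷ L↑ seg inA ∷ L↓ seg inA ∷ []) ×
    DimLE (Q seg inA) 4
proposition6 n seg inA _ dc _ =
  realizer seg inA dc , (_ , s≤s (s≤s (s≤s (s≤s z≤n))) , realizer seg inA dc)
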